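{- Let $n\geq1$, $\boldsymbol{\varepsilon}=(\varepsilon_1,\ldots,\varepsilon_n)\in\{\pm1\}^n$, and let $C=C(\boldsymbol{\varepsilon})$ be given by $C_{i,j}\coloneqq\prod_{k=i}^j\varepsilon_k$ for $1\leq i\leq j\leq n$. Let $1\leq i\leq j\leq n$ with $C_{i,j}=-1$ and $i+j$ odd. Then $V(i,j) = 2V^w(i,j)-1$ and $H(i,j)=2H^w(i,j)-1$; consequently $H^w(i,j) + V^w(i,j) = 1$, and in particular at least one of $H^w(i,j)$, $V^w(i,j)$ is positive.
   Context: $H(i,j)\coloneqq\sum_{u=i}^{j-1} C_{i,u}$ and $V(i,j)\coloneqq\sum_{v=i+1}^{j} C_{v,j}$. An entry $C_{r,s}$ is called correct if $C_{r,s}=(-1)^{r-s+1}$ and wrong otherwise. For $i\leq j$ define $H_{\pm}^w(i,j)\coloneqq \#\{k\colon i\leq k\leq j-1,\ C_{i,k}=\pm,\ C_{i,k}\text{ wrong}\}$, $V_{\pm}^w(i,j)\coloneqq \#\{k\colon i+1\leq k\leq j,\ C_{k,j}=\pm,\ C_{k,j}\text{ wrong}\}$, $H^w(i,j)\coloneqq H_{+}^w(i,j)-H_{ - }^w(i,j)$ and $V^w(i,j)\coloneqq V_{+}^w(i,j)-V_{ - }^w(i,j)$. -}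

module Defs where

open import Data.Nat as ℕ using (ℕ; zero; suc; _∸_)
open import Data.Integer using (ℤ; +_; -1ℤ; 1ℤ; 0ℤ; _^_; _-_) renaming (_+_ to _+ℤ_; _*_ to _*ℤ_)
open import Data.Integer.Properties using () renaming (_≟_ to _≟ℤ_)
open import Relation.Nullary using (does; ¬_)
open import Relation.Nullary.Decidable using (_×-dec_; ¬?)
open import Relation.Binary.PropositionalEquality using (_≡_)
open import Data.Product using (_×_)
open import Data.Bool using (if_then_else_)

-- A sign sequence ε_1,…,ε_n is a function ℕ → ℤ; only indices 1..n matter.

prodRange : (ℕ → ℤ) → ℕ → ℕ → ℤ
prodRange ε a zero    = 1ℤ
prodRange ε a (suc m) = ε a *ℤ prodRange ε (suc a) m

sumRange : (ℕ → ℤ) → ℕ → ℕ → ℤ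
sumRange f a zero    = 0ℤ
sumRange f a (suc m) = f a +ℤ sumRange f (suc a) m

C : (ℕ → ℤ) → ℕ → ℕ → ℤ
C ε i j = prodRange ε i (suc j ∸ i)

H : (ℕ → ℤ) → ℕ → ℕ → ℤ
H ε i j = sumRange (λ u → C ε i u) i (j ∸ i)

V : (ℕ → ℤ) → ℕ → ℕ → ℤ
V ε i j = sumRange (λ v → C ε v j) (suc i) (j ∸ i)

-- the "correct" value (-1)^{r-s+1}; since r-s+1 ≡ r+s+1 (mod 2) we use r+s+1
correctVal : ℕ → ℕ → ℤ
correctVal r s = -1ℤ ^ (r ℕ.+ s ℕ.+ 1)

Wrong : (ℕ → ℤ) → ℕ → ℕ → Set
Wrong ε r s = ¬ (C ε r s ≡ correctVal r s)

wrongInd : (ℕ → ℤ) → ℤ → ℕ → ℕ → ℤ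
wrongInd ε σ r s =
  if does ((C ε r s ≟ℤ σ) ×-dec ¬? (C ε r s ≟ℤ correctVal r s)) then 1ℤ else 0ℤ

Hw± : (ℕ → ℤ) → ℤ → ℕ → ℕ → ℤ
Hw± ε σ i j = sumRange (λ k → wrongInd ε σ i k) i (j ∸ i)

Vw± : (ℕ → ℤ) → ℤ → ℕ → ℕ → ℤ
Vw± ε σ i j = sumRange (λ k → wrongInd ε σ k j) (suc i) (j ∸ i)

Hw : (ℕ → ℤ) → ℕ → ℕ → ℤ
Hw ε i j = Hw± ε 1ℤ i j - Hw± ε -1ℤ i j

Vw : (ℕ → ℤ) → ℕ → ℕ → ℤ
Vw ε i j = Vw± ε 1ℤ i j - Vw± ε -1ℤ i j

-- Every entry of C is ±1, so an entry equals its correct value plus twice its signed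
-- wrongness (+2 for a wrong +1, −2 for a wrong −1). Summed along a row or a column this gives
-- H = Σ (correct values) + 2 H^w and V = Σ (correct values) + 2 V^w. The correct values
-- alternate in sign and both sums have the odd length j − i, so each reduces to its first
-- term, which is −1 because i + i and (i + 1) + j are even. Finally C_{v,j} = C_{i,j} / C_{i,v−1}
-- = −C_{i,v−1}, so V = −H, whence 2V^w − 1 = 1 − 2H^w.
module Submission where

open import Defs
open import Data.Nat using (ℕ; _≤_; _%_) renaming (_+_ to _+ℕ_)
open import Data.Integer using (ℤ; +_; -1ℤ; 1ℤ; 0ℤ; _+_; _*_; _-_; _<_)
open import Data.Product using (_×_)
open import Data.Sum using (_⊎_)
open import Relation.Binary.PropositionalEquality using (_≡_)

open import Data.Nat as ℕ using (zero; suc; _∸_; s≤s; z≤n; s≤s⁻¹)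
open import Data.Nat.Properties
  using (+-suc; +-identityʳ; m≤m+n; m+n∸m≡n; m+[n∸m]≡n; +-∸-comm; +-monoʳ-<; <⇒≤; ≤-trans;
         m≤n⇒m≤1+n; m≤n⇒∃[o]m+o≡n)
open import Data.Integer using (-_; _^_; +[1+_]; -[1+_]; +<+)
open import Data.Integer.Properties
  using (-1*i≡-i; *-identityˡ; *-assoc; neg-involutive; neg-distrib-+; *-distribˡ-+; *-zeroʳ; *-cancelˡ-≡)
  renaming (_≟_ to _≟ℤ_; +-comm to +ℤ-comm; +-identityʳ to +ℤ-identityʳ; +-identityˡ to +ℤ-identityˡ)
open import Data.Integer.Tactic.RingSolver using (solve-∀)
open import Data.Product using (_,_)
open import Data.Sum using (inj₁; inj₂)
open import Data.Bool using (if_then_else_)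
open import Relation.Nullary using (does)
open import Relation.Nullary.Decidable using (_×-dec_; ¬?)
open import Relation.Binary.PropositionalEquality using (refl; sym; trans; cong; cong₂; subst; module ≡-Reasoning)

open ≡-Reasoning

IsSign : ℤ → Set
IsSign x = x ≡ 1ℤ ⊎ x ≡ -1ℤ

SignSequence : (ℕ → ℤ) → ℕ → Set
SignSequence ε n = ∀ k → 1 ≤ k → k ≤ n → IsSign (ε k)

sign-* : ∀ {x y} → IsSign x → IsSign y → IsSign (x * y)
sign-* (inj₁ refl) (inj₁ refl) = inj₁ refl
sign-* (inj₁ refl) (inj₂ refl) = inj₂ refl
sign-* (inj₂ refl) (inj₁ refl) = inj₂ refl
sign-* (inj₂ refl) (inj₂ refl) = inj₁ refl

sign-^ : ∀ {x} k → IsSign x → IsSign (x ^ k)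
sign-^ zero    _ = inj₁ refl
sign-^ (suc k) s = sign-* s (sign-^ k s)

sign*y≡-1⇒y≡-sign : ∀ {x y} → IsSign x → x * y ≡ -1ℤ → y ≡ - x
sign*y≡-1⇒y≡-sign {y = y} (inj₁ refl) e = trans (sym (*-identityˡ y)) e
sign*y≡-1⇒y≡-sign {y = y} (inj₂ refl) e =
  trans (sym (neg-involutive y)) (cong -_ (trans (sym (-1*i≡-i y)) e))

wrongIndicator : ℤ → ℤ → ℤ → ℤ
wrongIndicator x σ c = if does ((x ≟ℤ σ) ×-dec ¬? (x ≟ℤ c)) then 1ℤ else 0ℤ

sign≡correct+2*wrong : ∀ {x c} → IsSign x → IsSign c →
                       x ≡ c + + 2 * (wrongIndicator x 1ℤ c - wrongIndicator x -1ℤ c)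
sign≡correct+2*wrong (inj₁ refl) (inj₁ refl) = refl
sign≡correct+2*wrong (inj₁ refl) (inj₂ refl) = refl
sign≡correct+2*wrong (inj₂ refl) (inj₁ refl) = refl
sign≡correct+2*wrong (inj₂ refl) (inj₂ refl) = refl

a+b≡1⇒0<a⊎0<b : ∀ a b → a + b ≡ 1ℤ → 0ℤ < a ⊎ 0ℤ < b
a+b≡1⇒0<a⊎0<b +[1+ _ ] _ _ = inj₁ (+<+ (s≤s z≤n))
a+b≡1⇒0<a⊎0<b (+ zero) b e = inj₂ (subst (0ℤ <_) (trans (sym e) (+ℤ-identityˡ b)) (+<+ (s≤s z≤n)))
a+b≡1⇒0<a⊎0<b -[1+ n ] b e = inj₂ (subst (0ℤ <_) (sym b≡2+n) (+<+ (s≤s z≤n)))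
  where
  b≡[a+b]-a : ∀ a b → b ≡ (a + b) - a
  b≡[a+b]-a = solve-∀
  b≡2+n : b ≡ +[1+ suc n ]
  b≡2+n = trans (b≡[a+b]-a -[1+ n ] b) (cong (_- -[1+ n ]) e)

2b-1≡-[2a-1]⇒a+b≡1 : ∀ a b → + 2 * b - 1ℤ ≡ - (+ 2 * a - 1ℤ) → a + b ≡ 1ℤ
2b-1≡-[2a-1]⇒a+b≡1 a b e = *-cancelˡ-≡ (+ 2) (a + b) 1ℤ (begin
  + 2 * (a + b)                    ≡⟨ expand a b ⟩
  (+ 2 * b - 1ℤ) + + 2 * a + 1ℤ     ≡⟨ cong (λ t → t + + 2 * a + 1ℤ) e ⟩
  - (+ 2 * a - 1ℤ) + + 2 * a + 1ℤ   ≡⟨ cancel a ⟩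
  + 2 * 1ℤ                         ∎)
  where
  expand : ∀ a b → + 2 * (a + b) ≡ (+ 2 * b - 1ℤ) + + 2 * a + 1ℤ
  expand = solve-∀
  cancel : ∀ a → - (+ 2 * a - 1ℤ) + + 2 * a + 1ℤ ≡ + 2 * 1ℤ
  cancel = solve-∀

sumRange-cong : ∀ {f g : ℕ → ℤ} b m → (∀ d → d ℕ.< m → f (b +ℕ d) ≡ g (b +ℕ d)) →
                sumRange f b m ≡ sumRange g b m
sumRange-cong b zero    _ = refl
sumRange-cong {f} {g} b (suc m) f≗g = cong₂ _+_ head (sumRange-cong (suc b) m tail)
  where
  head : f b ≡ g b
  head = subst (λ k → f k ≡ g k) (+-identityʳ b) (f≗g 0 (s≤s z≤n))
  tail : ∀ d → d ℕ.< m → f (suc b +ℕ d) ≡ g (suc b +ℕ d)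
  tail d d<m = subst (λ k → f k ≡ g k) (+-suc b d) (f≗g (suc d) (s≤s d<m))

sumRange-suc : ∀ f b m → sumRange f (suc b) m ≡ sumRange (λ k → f (suc k)) b m
sumRange-suc f b zero    = refl
sumRange-suc f b (suc m) = cong (λ t → f (suc b) + t) (sumRange-suc f (suc b) m)

sumRange-+ : ∀ f g b m → sumRange (λ k → f k + g k) b m ≡ sumRange f b m + sumRange g b m
sumRange-+ f g b zero    = refl
sumRange-+ f g b (suc m) = begin
  f b + g b + sumRange (λ k → f k + g k) (suc b) m
    ≡⟨ cong (λ t → f b + g b + t) (sumRange-+ f g (suc b) m) ⟩
  f b + g b + (sumRange f (suc b) m + sumRange g (suc b) m)
    ≡⟨ interchange (f b) (g b) _ _ ⟩
  f b + sumRange f (suc b) m + (g b + sumRange g (suc b) m) ∎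
  where
  interchange : ∀ a b c d → a + b + (c + d) ≡ a + c + (b + d)
  interchange = solve-∀

sumRange-neg : ∀ f b m → sumRange (λ k → - f k) b m ≡ - sumRange f b m
sumRange-neg f b zero    = refl
sumRange-neg f b (suc m) =
  trans (cong (λ t → - f b + t) (sumRange-neg f (suc b) m)) (sym (neg-distrib-+ (f b) _))

sumRange-*ˡ : ∀ a f b m → sumRange (λ k → a * f k) b m ≡ a * sumRange f b m
sumRange-*ˡ a f b zero    = sym (*-zeroʳ a)
sumRange-*ˡ a f b (suc m) =
  trans (cong (λ t → a * f b + t) (sumRange-*ˡ a f (suc b) m)) (sym (*-distribˡ-+ a (f b) _))

sumRange-alternating : ∀ f → (∀ k → f (suc k) ≡ - f k) → ∀ b m → m % 2 ≡ 1 → sumRange f b m ≡ f b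
sumRange-alternating f alt b zero          ()
sumRange-alternating f alt b (suc zero)    _   = +ℤ-identityʳ (f b)
sumRange-alternating f alt b (suc (suc m)) odd = begin
  f b + (f (suc b) + sumRange f (suc (suc b)) m)
    ≡⟨ cong (λ t → f b + (f (suc b) + t)) (sumRange-alternating f alt (suc (suc b)) m odd) ⟩
  f b + (f (suc b) + f (suc (suc b)))
    ≡⟨ cong₂ (λ s t → f b + (s + t)) (alt b) (trans (alt (suc b)) (cong -_ (alt b))) ⟩
  f b + (- f b + - - f b)
    ≡⟨ cancel (f b) ⟩
  f b ∎
  where
  cancel : ∀ a → a + (- a + - - a) ≡ a
  cancel = solve-∀

sumRange-signs : ∀ (x c : ℕ → ℤ) b m → (∀ d → d ℕ.< m → IsSign (x (b +ℕ d))) → (∀ k → IsSign (c k)) →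
                 sumRange x b m ≡ sumRange c b m + + 2 *
                   (sumRange (λ k → wrongIndicator (x k) 1ℤ (c k)) b m
                    - sumRange (λ k → wrongIndicator (x k) -1ℤ (c k)) b m)
sumRange-signs x c b m x-sign c-sign = begin
  sumRange x b m
    ≡⟨ sumRange-cong b m (λ d d<m → sign≡correct+2*wrong (x-sign d d<m) (c-sign (b +ℕ d))) ⟩
  sumRange (λ k → c k + + 2 * (w₊ k - w₋ k)) b m
    ≡⟨ sumRange-+ c _ b m ⟩
  sumRange c b m + sumRange (λ k → + 2 * (w₊ k - w₋ k)) b m
    ≡⟨ cong (λ t → sumRange c b m + t) (sumRange-*ˡ (+ 2) _ b m) ⟩
  sumRange c b m + + 2 * sumRange (λ k → w₊ k - w₋ k) b m
    ≡⟨ cong (λ t → sumRange c b m + + 2 * t) (sumRange-+ w₊ (λ k → - w₋ k) b m) ⟩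
  sumRange c b m + + 2 * (sumRange w₊ b m + sumRange (λ k → - w₋ k) b m)
    ≡⟨ cong (λ t → sumRange c b m + + 2 * (sumRange w₊ b m + t)) (sumRange-neg w₋ b m) ⟩
  sumRange c b m + + 2 * (sumRange w₊ b m - sumRange w₋ b m) ∎
  where
  w₊ w₋ : ℕ → ℤ
  w₊ k = wrongIndicator (x k) 1ℤ (c k)
  w₋ k = wrongIndicator (x k) -1ℤ (c k)

[m+m]%2≡0 : ∀ m → (m +ℕ m) % 2 ≡ 0
[m+m]%2≡0 zero    = refl
[m+m]%2≡0 (suc m) rewrite +-suc m m = [m+m]%2≡0 m

[m+[m+n]]%2≡n%2 : ∀ m n → (m +ℕ (m +ℕ n)) % 2 ≡ n % 2
[m+[m+n]]%2≡n%2 zero    n = refl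
[m+[m+n]]%2≡n%2 (suc m) n rewrite +-suc m (m +ℕ n) = [m+[m+n]]%2≡n%2 m n

[m+n]%2≡[n∸m]%2 : ∀ {m n} → m ≤ n → (m +ℕ n) % 2 ≡ (n ∸ m) % 2
[m+n]%2≡[n∸m]%2 {m} m≤n with m≤n⇒∃[o]m+o≡n m≤n
... | o , refl rewrite m+n∸m≡n m o = [m+[m+n]]%2≡n%2 m o

n%2≡1⇒[1+n]%2≡0 : ∀ n → n % 2 ≡ 1 → suc n % 2 ≡ 0
n%2≡1⇒[1+n]%2≡0 (suc zero)    _   = refl
n%2≡1⇒[1+n]%2≡0 (suc (suc n)) odd = n%2≡1⇒[1+n]%2≡0 n odd

-1^[k+1]≡-1 : ∀ k → k % 2 ≡ 0 → -1ℤ ^ (k +ℕ 1) ≡ -1ℤ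
-1^[k+1]≡-1 zero          _    = refl
-1^[k+1]≡-1 (suc (suc k)) even rewrite -1^[k+1]≡-1 k even = refl

correctVal-sign : ∀ r s → IsSign (correctVal r s)
correctVal-sign r s = sign-^ (r +ℕ s +ℕ 1) (inj₂ refl)

correctVal-sucˡ : ∀ r s → correctVal (suc r) s ≡ - correctVal r s
correctVal-sucˡ r s = -1*i≡-i (correctVal r s)

correctVal-sucʳ : ∀ r s → correctVal r (suc s) ≡ - correctVal r s
correctVal-sucʳ r s rewrite +-suc r s = -1*i≡-i (correctVal r s)

d<n∸m⇒m+d<n : ∀ {m n d} → m ≤ n → d ℕ.< n ∸ m → m +ℕ d ℕ.< n
d<n∸m⇒m+d<n {m} {d = d} m≤n d<n∸m = subst (m +ℕ d ℕ.<_) (m+[n∸m]≡n m≤n) (+-monoʳ-< m d<n∸m)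

prodRange-split : ∀ ε a p q → prodRange ε a (p +ℕ q) ≡ prodRange ε a p * prodRange ε (a +ℕ p) q
prodRange-split ε a zero    q = trans (cong (λ b → prodRange ε b q) (sym (+-identityʳ a))) (sym (*-identityˡ _))
prodRange-split ε a (suc p) q = begin
  ε a * prodRange ε (suc a) (p +ℕ q)
    ≡⟨ cong (ε a *_) (prodRange-split ε (suc a) p q) ⟩
  ε a * (prodRange ε (suc a) p * prodRange ε (suc a +ℕ p) q)
    ≡⟨ sym (*-assoc (ε a) _ _) ⟩
  ε a * prodRange ε (suc a) p * prodRange ε (suc a +ℕ p) q
    ≡⟨ cong (λ b → ε a * prodRange ε (suc a) p * prodRange ε b q) (sym (+-suc a p)) ⟩
  ε a * prodRange ε (suc a) p * prodRange ε (a +ℕ suc p) q ∎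

prodRange-sign : ∀ ε a m → (∀ d → d ℕ.< m → IsSign (ε (a +ℕ d))) → IsSign (prodRange ε a m)
prodRange-sign ε a zero    _    = inj₁ refl
prodRange-sign ε a (suc m) sign = sign-* head (prodRange-sign ε (suc a) m tail)
  where
  head : IsSign (ε a)
  head = subst (λ k → IsSign (ε k)) (+-identityʳ a) (sign 0 (s≤s z≤n))
  tail : ∀ d → d ℕ.< m → IsSign (ε (suc a +ℕ d))
  tail d d<m = subst (λ k → IsSign (ε k)) (+-suc a d) (sign (suc d) (s≤s d<m))

C-sign : ∀ {n ε r s} → SignSequence ε n → 1 ≤ r → r ≤ s → s ≤ n → IsSign (C ε r s)
C-sign {ε = ε} {r} {s} signs 1≤r r≤s s≤n = prodRange-sign ε r (suc s ∸ r) factor-sign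
  where
  factor-sign : ∀ d → d ℕ.< suc s ∸ r → IsSign (ε (r +ℕ d))
  factor-sign d d<len = signs (r +ℕ d) (≤-trans 1≤r (m≤m+n r d))
    (≤-trans (s≤s⁻¹ (d<n∸m⇒m+d<n (m≤n⇒m≤1+n r≤s) d<len)) s≤n)

C-split : ∀ ε {i v j} → i ≤ suc v → v ≤ j → C ε i j ≡ C ε i v * C ε (suc v) j
C-split ε {i} {v} {j} i≤1+v v≤j = begin
  prodRange ε i (suc j ∸ i)
    ≡⟨ cong (prodRange ε i) length-split ⟩
  prodRange ε i ((suc v ∸ i) +ℕ (j ∸ v))
    ≡⟨ prodRange-split ε i (suc v ∸ i) (j ∸ v) ⟩
  prodRange ε i (suc v ∸ i) * prodRange ε (i +ℕ (suc v ∸ i)) (j ∸ v)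
    ≡⟨ cong (λ a → C ε i v * prodRange ε a (j ∸ v)) (m+[n∸m]≡n i≤1+v) ⟩
  C ε i v * C ε (suc v) j ∎
  where
  length-split : suc j ∸ i ≡ (suc v ∸ i) +ℕ (j ∸ v)
  length-split = trans (cong (λ k → suc k ∸ i) (sym (m+[n∸m]≡n v≤j))) (+-∸-comm (j ∸ v) i≤1+v)

C[1+v,j]≡-C[i,v] : ∀ ε {i v j} → C ε i j ≡ -1ℤ → IsSign (C ε i v) → i ≤ suc v → v ≤ j →
                   C ε (suc v) j ≡ - C ε i v
C[1+v,j]≡-C[i,v] ε Cij≡-1 sign i≤1+v v≤j =
  sign*y≡-1⇒y≡-sign sign (trans (sym (C-split ε i≤1+v v≤j)) Cij≡-1)

C-row-sign : ∀ {n ε i j} → SignSequence ε n → 1 ≤ i → i ≤ j → j ≤ n →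
             ∀ d → d ℕ.< j ∸ i → IsSign (C ε i (i +ℕ d))
C-row-sign signs 1≤i i≤j j≤n d d<j∸i =
  C-sign signs 1≤i (m≤m+n _ d) (≤-trans (<⇒≤ (d<n∸m⇒m+d<n i≤j d<j∸i)) j≤n)

H≡2*Hw-1 : ∀ {n ε i j} → SignSequence ε n → 1 ≤ i → i ≤ j → j ≤ n → (j ∸ i) % 2 ≡ 1 →
           H ε i j ≡ + 2 * Hw ε i j - 1ℤ
H≡2*Hw-1 {ε = ε} {i} {j} signs 1≤i i≤j j≤n odd = begin
  H ε i j
    ≡⟨ sumRange-signs (C ε i) (correctVal i) i (j ∸ i) (C-row-sign signs 1≤i i≤j j≤n) (correctVal-sign i) ⟩
  sumRange (correctVal i) i (j ∸ i) + + 2 * Hw ε i j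
    ≡⟨ cong (λ t → t + + 2 * Hw ε i j) correct-sum ⟩
  -1ℤ + + 2 * Hw ε i j
    ≡⟨ +ℤ-comm -1ℤ (+ 2 * Hw ε i j) ⟩
  + 2 * Hw ε i j - 1ℤ ∎
  where
  correct-sum : sumRange (correctVal i) i (j ∸ i) ≡ -1ℤ
  correct-sum = trans (sumRange-alternating (correctVal i) (correctVal-sucʳ i) i (j ∸ i) odd)
                      (-1^[k+1]≡-1 (i +ℕ i) ([m+m]%2≡0 i))

V≡2*Vw-1 : ∀ {n ε i j} → SignSequence ε n → i ≤ j → j ≤ n → (i +ℕ j) % 2 ≡ 1 →
           V ε i j ≡ + 2 * Vw ε i j - 1ℤ
V≡2*Vw-1 {ε = ε} {i} {j} signs i≤j j≤n odd = begin
  V ε i j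
    ≡⟨ sumRange-signs (λ v → C ε v j) (λ v → correctVal v j) (suc i) (j ∸ i)
                      column-sign (λ v → correctVal-sign v j) ⟩
  sumRange (λ v → correctVal v j) (suc i) (j ∸ i) + + 2 * Vw ε i j
    ≡⟨ cong (λ t → t + + 2 * Vw ε i j) correct-sum ⟩
  -1ℤ + + 2 * Vw ε i j
    ≡⟨ +ℤ-comm -1ℤ (+ 2 * Vw ε i j) ⟩
  + 2 * Vw ε i j - 1ℤ ∎
  where
  column-sign : ∀ d → d ℕ.< j ∸ i → IsSign (C ε (suc i +ℕ d) j)
  column-sign d d<j∸i = C-sign signs (s≤s z≤n) (d<n∸m⇒m+d<n i≤j d<j∸i) j≤n
  correct-sum : sumRange (λ v → correctVal v j) (suc i) (j ∸ i) ≡ -1ℤ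
  correct-sum = trans (sumRange-alternating (λ v → correctVal v j) (λ v → correctVal-sucˡ v j) (suc i) (j ∸ i)
                                            (trans (sym ([m+n]%2≡[n∸m]%2 i≤j)) odd))
                      (-1^[k+1]≡-1 (suc (i +ℕ j)) (n%2≡1⇒[1+n]%2≡0 (i +ℕ j) odd))

V≡-H : ∀ {n ε i j} → SignSequence ε n → 1 ≤ i → i ≤ j → j ≤ n → C ε i j ≡ -1ℤ → V ε i j ≡ - H ε i j
V≡-H {ε = ε} {i} {j} signs 1≤i i≤j j≤n Cij≡-1 = begin
  V ε i j                                   ≡⟨ sumRange-suc (λ v → C ε v j) i (j ∸ i) ⟩
  sumRange (λ v → C ε (suc v) j) i (j ∸ i)  ≡⟨ sumRange-cong i (j ∸ i) reflect ⟩
  sumRange (λ u → - C ε i u) i (j ∸ i)      ≡⟨ sumRange-neg (C ε i) i (j ∸ i) ⟩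
  - H ε i j                                 ∎
  where
  reflect : ∀ d → d ℕ.< j ∸ i → C ε (suc (i +ℕ d)) j ≡ - C ε i (i +ℕ d)
  reflect d d<j∸i = C[1+v,j]≡-C[i,v] ε Cij≡-1 (C-row-sign signs 1≤i i≤j j≤n d d<j∸i)
                      (m≤n⇒m≤1+n (m≤m+n i d)) (<⇒≤ (d<n∸m⇒m+d<n i≤j d<j∸i))

lemma6 : (n : ℕ) → 1 ≤ n → (ε : ℕ → ℤ) →
         (∀ k → 1 ≤ k → k ≤ n → (ε k ≡ 1ℤ ⊎ ε k ≡ -1ℤ)) →
         (i j : ℕ) → 1 ≤ i → i ≤ j → j ≤ n →
         C ε i j ≡ -1ℤ → (i +ℕ j) % 2 ≡ 1 →
         (V ε i j ≡ + 2 * Vw ε i j - 1ℤ)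
         × (H ε i j ≡ + 2 * Hw ε i j - 1ℤ)
         × (Hw ε i j + Vw ε i j ≡ 1ℤ)
         × (0ℤ < Hw ε i j ⊎ 0ℤ < Vw ε i j)
lemma6 n _ ε signs i j 1≤i i≤j j≤n Cij≡-1 i+j-odd = V-eq , H-eq , Hw+Vw≡1 , a+b≡1⇒0<a⊎0<b _ _ Hw+Vw≡1
  where
  V-eq : V ε i j ≡ + 2 * Vw ε i j - 1ℤ
  V-eq = V≡2*Vw-1 signs i≤j j≤n i+j-odd
  H-eq : H ε i j ≡ + 2 * Hw ε i j - 1ℤ
  H-eq = H≡2*Hw-1 signs 1≤i i≤j j≤n (trans (sym ([m+n]%2≡[n∸m]%2 i≤j)) i+j-odd)
  Hw+Vw≡1 : Hw ε i j + Vw ε i j ≡ 1ℤ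
  Hw+Vw≡1 = 2b-1≡-[2a-1]⇒a+b≡1 (Hw ε i j) (Vw ε i j)
              (trans (sym V-eq) (trans (V≡-H signs 1≤i i≤j j≤n Cij≡-1) (cong -_ H-eq)))
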